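{- Under the standing assumptions below, let $A\subseteq V_G$ be strongly compressed and let $(s_1,\dots,s_d)$ be the start of the first block of some slice $\mathrm{Slice}_G(q)$. If for some $i\in\{2,\dots,d\}$ $$\{s_1\}\times\cdots\times\{s_{i-1}\}\times V_{G_i}\times\{s_{i+1}\}\times\cdots\times\{s_d\}\subseteq A,$$ then $\mathrm{Slice}_G(p)\subseteq A$ for all $p<q$.
   Context: All graphs are finite and simple. For $G=(V,E)$, $I_G(A,B)$ is the set of edges with one end in $A$ and the other in $B$, $I_G(A)=I_G(A,A)$, $I_G(m)=\max_{|S|=m}|I_G(S)|$. A total order is a bijection $\mathcal O:V\to\{1,\dots,|V|\}$, $\mathcal O[k,l]=\mathcal O^{ -1}(\{k,\dots,l\})$; it is optimal if $|I_G(\mathcal O[1,k])|=I_G(k)$ for all $k$; $G$ is isoperimetric if it has one. $\delta_G(1)=0$, $\delta_G(m)=I_G(m)-I_G(m-1)$. Cartesian product $G_1\square\cdots\square G_d$: tuples adjacent iff they differ in exactly one coordinate, where they are adjacent. Lexicographic order on $\mathbb R^k$: $x<y$ iff for some $i$, $x_1=y_1,\dots,x_i=y_i$, $x_{i+1}<y_{i+1}$. For $\pi\in\mathfrak S_k$, $\mathcal D^{\pi,k}$ compares $(x_{\pi(1)},\dots,x_{\pi(k)})$ lexicographically; orders on $\mathbb R^k$ induce orders on products of ordered sets via rank tuples. Isoperimetric partition of isoperimetric $G$ with optimal $\mathcal O_G$: partition into consecutive intervals $\mathcal O_G[a_i,b_i]$ such that each part induces an isoperimetric subgraph with the restricted order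 optimal, and every $v\in\mathcal O_G[a_i,b_i]$ has exactly $\delta_G(a_i)$ neighbours in $\mathcal O_G[a_1,b_{i-1}]$. Starts of parts are their first vertices. Non-decreasing: each part's induced subgraph has non-decreasing $\delta$-sequence. Regular: first and last parts' induced subgraphs have equal $\delta$-sequences. Setup: $G_i=(V_{G_i},E_{G_i})$ ($1\le i\le d$) isoperimetric with fixed optimal orders $\mathcal O_{G_i}$ and isoperimetric partitions $\mathfrak P_{G_i}$; $G=G_1\square\cdots\square G_d$; $G_S=G_{i_1}\square\cdots\square G_{i_k}$ for $S=\{i_1<\dots<i_k\}$. Blocks of $G_S$: $Z_{i_1}\times\cdots\times Z_{i_k}$, $Z_{i_j}\in\mathfrak P_{G_{i_j}}$; start: tuple of starts. An order $\mathcal O$ on a product is consistent with an order $\mathcal O'$ on the subproduct over $S$ if $x<_{\mathcal O}y$ and $x_j=y_j$ for $j\notin S$ imply the same inequality of projections in $\mathcal O'$. Domination collection: each block $B$ of each $G_S$ has $\pi_B\in\mathfrak S_{|S|}$ such that the order $\mathcal D_B$ induced by $\mathcal D^{\pi_B,|S|}$ on $B$ (coordinates ranked by restrictions of $\mathcal O_{G_{i_j}}$) is optimal for the subgraph induced by $B$, and for $S_1\subset S_2$, $\mathcal D_{B_2}$ is consistent with $\mathcal D_{B_1}$ when $B_1$ consists of the factors of $B_2$ indexed by $S_1$. $\mathcal{BL}^k_{G_S}$: same block: compare by $\mathcal D_B$; different blocks: compare starts lexicographically; $\mathcal{BL}^d_G=\mathcal{BL}^d_{G_{\{1,\dots,d\}}}$.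 Regular domination collection: $\mathfrak P_{G_i}$ regular for $2\le i\le d-1$, and $\pi_{B_1}=\pi_{B_2}$ for $B_1$ (resp. $B_2$) the product of the first (resp. last) parts of $\mathfrak P_{G_2},\dots,\mathfrak P_{G_{d-1}}$. Standing assumptions: $d\ge3$; the $\mathfrak P_{G_i}$ form a regular domination collection; $\mathfrak P_{G_i}$ non-decreasing for $i\le d-1$; $\mathcal{BL}^2_{G_i\square G_j}$ optimal for all $i<j$. Compression: for nonempty proper $S$ with an order on $G_S$, and $x\in V_{G_{\overline S}}$, the section $G_S(x)$ is the set of vertices of $G$ with $\overline S$-coordinates equal to $x$, ordered via its isomorphism with $G_S$; compression replaces each $A\cap G_S(x)$ by the initial segment of $G_S(x)$ of the same size. $A$ is strongly compressed if it is unchanged by compression for every nonempty proper $S$ with respect to $\mathcal{BL}^{|S|}_{G_S}$. Geometry: blocks of $G$ are ordered by $\mathcal{BL}^d_G$ of their starts. With $t_1,t_2,\dots$ the starts of the parts of $\mathfrak P_{G_1}$ in increasing $\mathcal O_{G_1}$-order, $\mathrm{Slice}_G(q)$ is the union of all blocks whose start has first coordinate $t_q$. -}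

module Defs where

open import Data.Bool using (Bool; true; false; T; _∧_; _∨_; if_then_else_; not)
open import Data.Nat using (ℕ; zero; suc; _+_; _∸_; _≤_; _<_; _≡ᵇ_; _<ᵇ_)
open import Data.Fin using (Fin; toℕ; inject₁) renaming (zero to fzero; suc to fsuc)
import Data.Fin as Fin
open import Data.Fin.Permutation using (Permutation′; _⟨$⟩ʳ_; _⟨$⟩ˡ_)
open import Data.List using (List; []; _∷_; [_]; length; map; filterᵇ; take; concatMap; upTo; allFin; lookup)
open import Data.Nat.ListAction using (sum)
open import Data.Bool.ListAction using (all; any)
open import Data.List.Relation.Unary.All using (All; []; _∷_)
import Data.List.Relation.Unary.All as All
open import Data.List.Relation.Unary.AllPairs using (AllPairs)
open import Data.List.Relation.Unary.Linked using (Linked)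
open import Data.List.Relation.Unary.Unique.Propositional using (Unique)
open import Data.List.Membership.Propositional using (_∈_; _∉_)
open import Data.List.Membership.Propositional.Properties using (∈-lookup; ∈-allFin)
open import Data.List.Relation.Binary.Subset.Propositional using (_⊆_)
open import Data.Product using (Σ; _×_; _,_; ∃)
open import Relation.Nullary using (¬_; does)
open import Relation.Binary.PropositionalEquality using (_≡_)
open import Data.Empty using (⊥)

-- A (finite, duplicate-free) list of vertices
-- represents a total order on the set of its entries (first = smallest).

countB : {V : Set} → (V → Bool) → List V → ℕ
countB p xs = sum (map (λ y → if p y then 1 else 0) xs)

edgesL : {V : Set} → (V → V → Bool) → List V → ℕ
edgesL adj []       = 0
edgesL adj (x ∷ xs) = countB (adj x) xs + edgesL adj xs

IsOptimalList : {V : Set} → (V → V → Bool) → List V → Set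
IsOptimalList {V} adj L =
  Unique L ×
  ((S : List V) → Unique S → S ⊆ L → edgesL adj S ≤ edgesL adj (take (length S) L))

IsOptimalOrder : {V : Set} → (V → V → Bool) → (V → V → Bool) → (V → Bool) → Set
IsOptimalOrder {V} adj R P =
  Σ (List V) λ L →
    AllPairs (λ x y → T (R x y)) L ×
    ((v : V) → v ∈ L → T (P v)) ×
    ((v : V) → T (P v) → v ∈ L) ×
    IsOptimalList adj L

-- δ(m) = I(m) - I(m-1) (with δ(1) = 0) computed along an optimal listing L
-- (m is 1-based); since L is optimal, I(m) = |I(L[1..m])|.
δ : {V : Set} → (V → V → Bool) → List V → ℕ → ℕ
δ adj L m = edgesL adj (take m L) ∸ edgesL adj (take (m ∸ 1) L)

δseq : {V : Set} → (V → V → Bool) → List V → List ℕ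
δseq adj L = map (λ m → δ adj L (suc m)) (upTo (length L))

lexᵇ : {k : ℕ} → (Fin k → ℕ) → (Fin k → ℕ) → Bool
lexᵇ {zero}  r s = false
lexᵇ {suc k} r s = (r fzero <ᵇ s fzero) ∨ ((r fzero ≡ᵇ s fzero) ∧ lexᵇ (λ t → r (fsuc t)) (λ t → s (fsuc t)))

eqTupleᵇ : {k : ℕ} → (Fin k → ℕ) → (Fin k → ℕ) → Bool
eqTupleᵇ {zero}  r s = true
eqTupleᵇ {suc k} r s = (r fzero ≡ᵇ s fzero) ∧ eqTupleᵇ (λ t → r (fsuc t)) (λ t → s (fsuc t))

_==ᶠ_ : {n : ℕ} → Fin n → Fin n → Bool
a ==ᶠ b = does (a Fin.≟ b)

-- start (as a rank) of the interval containing rank r, for the partition of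
-- {0,…,n-1} into consecutive intervals whose starts are 0 and the ranks r with
-- cut r ≡ true.
pstF : {n : ℕ} → (ℕ → Bool) → Fin n → Fin n
pstF cut fzero    = fzero
pstF cut (fsuc r) = if cut (suc (toℕ r)) then fsuc r else inject₁ (pstF cut r)

isStartᵇ : (ℕ → Bool) → ℕ → Bool
isStartᵇ cut r = (r ≡ᵇ 0) ∨ cut r

-- The setup: d factor graphs G_i (i : Fin d, 0-based), each a finite simple
-- graph on Fin (n i), with a total order O_i (a bijection onto ranks
-- 0,…,n i - 1), a partition 𝔓_i into consecutive O_i-intervals (encoded by
-- the cut points), and a choice of permutations π_B for the blocks of all
-- subproducts (a block is identified by its start vertex).

Vtx′ : {d : ℕ} → (Fin d → ℕ) → List (Fin d) → Set
Vtx′ n S = All (λ i → Fin (n i)) S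

record Setup : Set where
  field
    d    : ℕ
    n    : Fin d → ℕ
    adj  : (i : Fin d) → Fin (n i) → Fin (n i) → Bool
    adj-sym : (i : Fin d) (u v : Fin (n i)) → adj i u v ≡ adj i v u
    adj-irr : (i : Fin d) (u : Fin (n i)) → adj i u u ≡ false
    O    : (i : Fin d) → Permutation′ (n i)
    cut  : Fin d → ℕ → Bool
    π    : (S : List (Fin d)) → Vtx′ n S → Permutation′ (length S)

module _ (G : Setup) where
  open Setup G

  Vtx : List (Fin d) → Set
  Vtx S = Vtx′ n S

  full : List (Fin d)
  full = allFin d

  IsIndexSet : List (Fin d) → Set
  IsIndexSet S = AllPairs (Fin._<_) S

  rank : (i : Fin d) → Fin (n i) → Fin (n i)
  rank i v = O i ⟨$⟩ʳ v

  rankℕ : (i : Fin d) → Fin (n i) → ℕ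
  rankℕ i v = toℕ (rank i v)

  vertexAt : (i : Fin d) → Fin (n i) → Fin (n i)
  vertexAt i r = O i ⟨$⟩ˡ r

  orderList : (i : Fin d) → List (Fin (n i))
  orderList i = map (vertexAt i) (allFin (n i))

  partStart : (i : Fin d) → Fin (n i) → Fin (n i)
  partStart i v = vertexAt i (pstF (cut i) (rank i v))

  IsPartStart : (i : Fin d) → Fin (n i) → Set
  IsPartStart i v = T (isStartᵇ (cut i) (rankℕ i v))

  partList : (i : Fin d) → Fin (n i) → List (Fin (n i))
  partList i w = filterᵇ (λ v → partStart i v ==ᶠ w) (orderList i)

  IsFirstPartStart : (i : Fin d) → Fin (n i) → Set
  IsFirstPartStart i v = rankℕ i v ≡ 0

  IsLastPartStart : (i : Fin d) → Fin (n i) → Set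
  IsLastPartStart i v = IsPartStart i v × ((w : Fin (n i)) → IsPartStart i w → rankℕ i w ≤ rankℕ i v)

  IsIsoPartition : Fin d → Set
  IsIsoPartition i =
    ((w : Fin (n i)) → IsPartStart i w → IsOptimalList (adj i) (partList i w)) ×
    ((w : Fin (n i)) → IsPartStart i w → (v : Fin (n i)) → partStart i v ≡ w →
       countB (adj i v) (take (rankℕ i w) (orderList i)) ≡ δ (adj i) (orderList i) (suc (rankℕ i w)))

  NonDecreasingPartition : Fin d → Set
  NonDecreasingPartition i =
    (w : Fin (n i)) → IsPartStart i w → Linked _≤_ (δseq (adj i) (partList i w))

  RegularPartition : Fin d → Set
  RegularPartition i =
    (w₁ w₂ : Fin (n i)) → IsFirstPartStart i w₁ → IsLastPartStart i w₂ →
      δseq (adj i) (partList i w₁) ≡ δseq (adj i) (partList i w₂)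

  coordAt : {S : List (Fin d)} → Vtx S → (t : Fin (length S)) → Fin (n (lookup S t))
  coordAt v t = All.lookup v (∈-lookup t)

  coord : Vtx full → (i : Fin d) → Fin (n i)
  coord v i = All.lookup v (∈-allFin i)

  proj : {S₁ S₂ : List (Fin d)} → S₁ ⊆ S₂ → Vtx S₂ → Vtx S₁
  proj sub v = All.tabulate (λ m → All.lookup v (sub m))

  projFull : (S : List (Fin d)) → Vtx full → Vtx S
  projFull S v = proj (λ {i} _ → ∈-allFin i) v

  rkTuple : {S : List (Fin d)} → Vtx S → Fin (length S) → ℕ
  rkTuple {S} v t = rankℕ (lookup S t) (coordAt v t)

  diffCount : {S : List (Fin d)} → Vtx S → Vtx S → ℕ
  diffCount {[]}    []       []       = 0
  diffCount {i ∷ S} (a ∷ x) (b ∷ y) = (if a ==ᶠ b then 0 else 1) + diffCount x y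

  okCoords : {S : List (Fin d)} → Vtx S → Vtx S → Bool
  okCoords {[]}    []       []       = true
  okCoords {i ∷ S} (a ∷ x) (b ∷ y) = ((a ==ᶠ b) ∨ adj i a b) ∧ okCoords x y

  adjProd : (S : List (Fin d)) → Vtx S → Vtx S → Bool
  adjProd S x y = (diffCount x y ≡ᵇ 1) ∧ okCoords x y

  allVtx : (S : List (Fin d)) → List (Vtx S)
  allVtx []      = [] ∷ []
  allVtx (i ∷ S) = concatMap (λ a → map (a ∷_) (allVtx S)) (allFin (n i))

  -- blocks: a block of G_S is identified by its start (a tuple of part starts)
  blockStart : {S : List (Fin d)} → Vtx S → Vtx S
  blockStart v = All.map (λ {i} a → partStart i a) v

  IsBlockStart : (S : List (Fin d)) → Vtx S → Set
  IsBlockStart S b = (t : Fin (length S)) → IsPartStart (lookup S t) (coordAt b t)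

  inBlockᵇ : (S : List (Fin d)) → Vtx S → Vtx S → Bool
  inBlockᵇ S b v = eqTupleᵇ (rkTuple (blockStart v)) (rkTuple b)

  Dᵇ : (S : List (Fin d)) → Permutation′ (length S) → Vtx S → Vtx S → Bool
  Dᵇ S p x y = lexᵇ (λ t → rkTuple x (p ⟨$⟩ʳ t)) (λ t → rkTuple y (p ⟨$⟩ʳ t))

  BLᵇ : (S : List (Fin d)) → Vtx S → Vtx S → Bool
  BLᵇ S x y =
    lexᵇ (rkTuple (blockStart x)) (rkTuple (blockStart y)) ∨
    (eqTupleᵇ (rkTuple (blockStart x)) (rkTuple (blockStart y)) ∧ Dᵇ S (π S (blockStart x)) x y)

  NonEmpty : List (Fin d) → Set
  NonEmpty S = 1 ≤ length S

  middle : List (Fin d)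
  middle = filterᵇ (λ i → (1 ≤ᵇ′ toℕ i) ∧ (suc (toℕ i) <ᵇ d)) (allFin d)
    where
    _≤ᵇ′_ : ℕ → ℕ → Bool
    a ≤ᵇ′ b = a <ᵇ suc b

  record StandingAssumptions : Set where
    field
      d≥3        : 3 ≤ d
      isoperimetric : (i : Fin d) → IsOptimalList (adj i) (orderList i)
      isoPartition  : (i : Fin d) → IsIsoPartition i
      nonDecreasing : (i : Fin d) → suc (toℕ i) < d → NonDecreasingPartition i
      domOptimal : (S : List (Fin d)) → IsIndexSet S → NonEmpty S →
                   (b : Vtx S) → IsBlockStart S b →
                   IsOptimalOrder (adjProd S) (Dᵇ S (π S b)) (inBlockᵇ S b)
      domConsistent : (S₁ S₂ : List (Fin d)) → IsIndexSet S₁ → IsIndexSet S₂ →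
                   NonEmpty S₁ → (sub : S₁ ⊆ S₂) →
                   (b : Vtx S₂) → IsBlockStart S₂ b →
                   (x y : Vtx S₂) → T (inBlockᵇ S₂ b x) → T (inBlockᵇ S₂ b y) →
                   T (Dᵇ S₂ (π S₂ b) x y) →
                   ((i : Fin d) (m : i ∈ S₂) → i ∉ S₁ → All.lookup x m ≡ All.lookup y m) →
                   T (Dᵇ S₁ (π S₁ (proj sub b)) (proj sub x) (proj sub y))
      regularPartition : (i : Fin d) → 1 ≤ toℕ i → suc (toℕ i) < d → RegularPartition i
      regularπ : (b₁ b₂ : Vtx middle) →
                 ((t : Fin (length middle)) → IsFirstPartStart (lookup middle t) (coordAt b₁ t)) →
                 ((t : Fin (length middle)) → IsLastPartStart (lookup middle t) (coordAt b₂ t)) →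
                 (t : Fin (length middle)) → π middle b₁ ⟨$⟩ʳ t ≡ π middle b₂ ⟨$⟩ʳ t
      BL2optimal : (i j : Fin d) → i Fin.< j →
                   IsOptimalOrder (adjProd (i ∷ j ∷ [])) (BLᵇ (i ∷ j ∷ [])) (λ _ → true)

  _∈ᵇ_ : Fin d → List (Fin d) → Bool
  i ∈ᵇ S = any (λ j → i ==ᶠ j) S

  sameSectionᵇ : List (Fin d) → Vtx full → Vtx full → Bool
  sameSectionᵇ S v v' = all (λ i → (i ∈ᵇ S) ∨ (coord v i ==ᶠ coord v' i)) (allFin d)

  positionBL : (S : List (Fin d)) → Vtx S → ℕ
  positionBL S w = countB (λ w' → BLᵇ S w' w) (allVtx S)

  -- the compression of A w.r.t. S: in each section, A ∩ G_S(x) is replaced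
  -- by the initial segment of G_S(x) (ordered by 𝓑𝓛 via G_S(x) ≅ G_S) of size |A ∩ G_S(x)|
  compress : List (Fin d) → (Vtx full → Bool) → Vtx full → Bool
  compress S A v =
    positionBL S (projFull S v) <ᵇ countB (λ v' → sameSectionᵇ S v v' ∧ A v') (allVtx full)

  StronglyCompressed : (Vtx full → Bool) → Set
  StronglyCompressed A =
    (S : List (Fin d)) → IsIndexSet S → NonEmpty S → length S < d →
      (v : Vtx full) → compress S A v ≡ A v

  -- geometry
  -- (i₀ denotes the first factor G_1, i.e. toℕ i₀ ≡ 0)
  -- v ∈ Slice_G(q), where t = t_q is the start of the q-th part of 𝔓_{G_1}:
  -- the start of the block containing v has first coordinate t
  InSlice : (i₀ : Fin d) → Fin (n i₀) → Vtx full → Set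
  InSlice i₀ t v = coord (blockStart v) i₀ ≡ t

  IsFirstBlockStartOfSlice : (i₀ : Fin d) → Vtx full → Set
  IsFirstBlockStartOfSlice i₀ s =
    IsBlockStart full s ×
    ((s' : Vtx full) → IsBlockStart full s' → coord s' i₀ ≡ coord s i₀ → ¬ T (BLᵇ full s' s))

-- Let w agree with s except in coordinate i, where it agrees with v. Then w lies on the line
-- through s, so w ∈ A, and v, w lie in the same section G_S(x) for S = {1,…,d} ∖ {i}. Since
-- i ≠ 1, the first coordinate survives in S; there the block of v starts at t, strictly below
-- the part start s₁ at which the block of w starts. So v precedes w in 𝓑𝓛 on G_S, and as A
-- is compressed with respect to S, A ∩ G_S(x) is an initial segment containing w, hence v.
module Submission where

open import Defs
open import Data.Bool using (Bool; T; true; false; not; _∨_; _∧_; if_then_else_)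
open import Data.Bool.Properties using (T-∨; T-∧; T-≡; T-not-≡)
open import Data.Bool.ListAction using (and)
open import Data.Nat.ListAction using (sum)
open import Data.Nat using (ℕ; zero; suc; _≤_; _<_; _<ᵇ_; _≡ᵇ_; z≤n)
open import Data.Nat.Properties
  using (<ᵇ⇒<; <⇒<ᵇ; ≡ᵇ⇒≡; ≡⇒≡ᵇ; <-trans; <-≤-trans; ≤-<-trans; ≤-reflexive; ≤-refl; +-mono-≤)
open import Data.Fin using (Fin; toℕ) renaming (zero to fzero; suc to fsuc)
import Data.Fin as Fin
open import Data.Fin.Permutation using (inverseˡ)
open import Data.List using (List; []; _∷_; length; filterᵇ; allFin)
open import Data.List.Properties using (map-cong; length-tabulate; filter-notAll; filter-some)
import Data.List.Relation.Unary.Any as Any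
open import Data.List.Relation.Unary.Any.Properties using (any⁺)
import Data.List.Relation.Unary.All as All
open import Data.List.Relation.Unary.All.Properties using (lookup-map; lookup∘updateAt; lookup∘updateAt′)
open import Data.List.Relation.Unary.AllPairs using (AllPairs)
import Data.List.Relation.Unary.AllPairs.Properties as AllPairs
open import Data.List.Membership.Propositional using (_∈_)
open import Data.List.Membership.Propositional.Properties using (∈-allFin; ∈-filter⁺)
open import Data.Product using (_×_; _,_; proj₁; proj₂)
open import Data.Sum using (_⊎_; inj₁; inj₂)
open import Data.Empty using (⊥-elim)
open import Function using (_∘_; const)
open import Function.Bundles using (Equivalence)
open Equivalence using (to; from)
open import Relation.Nullary using (¬_; yes; no)
open import Relation.Nullary.Decidable using (T?; dec-true; dec-false)
open import Relation.Binary.PropositionalEquality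
  using (_≡_; _≢_; _≗_; refl; sym; trans; cong; cong₂; subst; subst₂)

lexᵇ-head : {k : ℕ} (r s : Fin (suc k) → ℕ) → T (lexᵇ r s) →
            r fzero < s fzero ⊎ (r fzero ≡ s fzero × T (lexᵇ (r ∘ fsuc) (s ∘ fsuc)))
lexᵇ-head r s h with to T-∨ h
... | inj₁ r₀<s₀ = inj₁ (<ᵇ⇒< (r fzero) (s fzero) r₀<s₀)
... | inj₂ r₀≡s₀∧tail with to T-∧ r₀≡s₀∧tail
...   | r₀≡s₀ , tail = inj₂ (≡ᵇ⇒≡ (r fzero) (s fzero) r₀≡s₀ , tail)

lexᵇ-here : {k : ℕ} (r s : Fin (suc k) → ℕ) → r fzero < s fzero → T (lexᵇ r s)
lexᵇ-here r s r₀<s₀ = from T-∨ (inj₁ (<⇒<ᵇ r₀<s₀))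

lexᵇ-there : {k : ℕ} (r s : Fin (suc k) → ℕ) → r fzero ≡ s fzero →
             T (lexᵇ (r ∘ fsuc) (s ∘ fsuc)) → T (lexᵇ r s)
lexᵇ-there r s r₀≡s₀ tail = from T-∨ (inj₂ (from T-∧ (≡⇒≡ᵇ (r fzero) (s fzero) r₀≡s₀ , tail)))

lexᵇ-trans : {k : ℕ} (r s u : Fin k → ℕ) → T (lexᵇ r s) → T (lexᵇ s u) → T (lexᵇ r u)
lexᵇ-trans {zero} r s u () _
lexᵇ-trans {suc k} r s u r<s s<u with lexᵇ-head r s r<s | lexᵇ-head s u s<u
... | inj₁ r₀<s₀       | inj₁ s₀<u₀       = lexᵇ-here r u (<-trans r₀<s₀ s₀<u₀)
... | inj₁ r₀<s₀       | inj₂ (s₀≡u₀ , _) = lexᵇ-here r u (<-≤-trans r₀<s₀ (≤-reflexive s₀≡u₀))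
... | inj₂ (r₀≡s₀ , _) | inj₁ s₀<u₀       = lexᵇ-here r u (≤-<-trans (≤-reflexive r₀≡s₀) s₀<u₀)
... | inj₂ (r₀≡s₀ , r<s′) | inj₂ (s₀≡u₀ , s<u′) =
  lexᵇ-there r u (trans r₀≡s₀ s₀≡u₀) (lexᵇ-trans (r ∘ fsuc) (s ∘ fsuc) (u ∘ fsuc) r<s′ s<u′)

eqTupleᵇ⇒≗ : {k : ℕ} (r s : Fin k → ℕ) → T (eqTupleᵇ r s) → r ≗ s
eqTupleᵇ⇒≗ r s h fzero    = ≡ᵇ⇒≡ (r fzero) (s fzero) (proj₁ (to T-∧ h))
eqTupleᵇ⇒≗ r s h (fsuc t) = eqTupleᵇ⇒≗ (r ∘ fsuc) (s ∘ fsuc) (proj₂ (to T-∧ h)) t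

lexᵇ-congˡ : {k : ℕ} {r s : Fin k → ℕ} (u : Fin k → ℕ) → r ≗ s → lexᵇ r u ≡ lexᵇ s u
lexᵇ-congˡ {zero}  u r≗s = refl
lexᵇ-congˡ {suc k} u r≗s =
  cong₂ (λ a b → (a <ᵇ u fzero) ∨ ((a ≡ᵇ u fzero) ∧ b))
        (r≗s fzero) (lexᵇ-congˡ (u ∘ fsuc) (r≗s ∘ fsuc))

eqTupleᵇ-lexᵇ : {k : ℕ} (r s u : Fin k → ℕ) → T (eqTupleᵇ r s) → T (lexᵇ s u) → T (lexᵇ r u)
eqTupleᵇ-lexᵇ r s u r≡s = subst T (sym (lexᵇ-congˡ u (eqTupleᵇ⇒≗ r s r≡s)))

indicator-mono : {a b : Bool} → (T a → T b) → (if a then 1 else 0) ≤ (if b then 1 else 0)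
indicator-mono {false}         _   = z≤n
indicator-mono {true} {true}   _   = ≤-refl
indicator-mono {true} {false}  a⇒b = ⊥-elim (a⇒b _)

countB-mono : {V : Set} (p q : V → Bool) → ((x : V) → T (p x) → T (q x)) →
              (xs : List V) → countB p xs ≤ countB q xs
countB-mono p q p⇒q []       = z≤n
countB-mono p q p⇒q (x ∷ xs) = +-mono-≤ (indicator-mono (p⇒q x)) (countB-mono p q p⇒q xs)

countB-cong : {V : Set} {p q : V → Bool} → p ≗ q → (xs : List V) → countB p xs ≡ countB q xs
countB-cong p≗q xs = cong sum (map-cong (cong (λ b → if b then 1 else 0) ∘ p≗q) xs)

allBut : {d : ℕ} → Fin d → List (Fin d)
allBut i = filterᵇ (λ j → not (j ==ᶠ i)) (allFin _)

module _ {d : ℕ} (i : Fin d) where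

  private
    keeps : {j : Fin d} → j ≢ i → T (not (j ==ᶠ i))
    keeps {j} j≢i = from T-not-≡ (dec-false (j Fin.≟ i) j≢i)

  allBut-sorted : AllPairs Fin._<_ (allBut i)
  allBut-sorted = AllPairs.filter⁺ (T? ∘ _) (AllPairs.tabulate⁺-< (λ j<k → j<k))

  ∈-allBut : {j : Fin d} → j ≢ i → j ∈ allBut i
  ∈-allBut j≢i = ∈-filter⁺ (T? ∘ _) (∈-allFin _) (keeps j≢i)

  allBut-nonEmpty : {j : Fin d} → j ≢ i → 1 ≤ length (allBut i)
  allBut-nonEmpty {j} j≢i = filter-some (T? ∘ _) (Any.map (λ { refl → keeps j≢i }) (∈-allFin j))

  length-allBut : length (allBut i) < d
  length-allBut = subst (length (allBut i) <_) (length-tabulate _)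
    (filter-notAll (T? ∘ _) (allFin d) (Any.map (λ { refl → dropsᵢ }) (∈-allFin i)))
    where
    dropsᵢ : ¬ T (not (i ==ᶠ i))
    dropsᵢ h with i Fin.≟ i
    ... | yes _   = h
    ... | no i≢i = i≢i refl

pstF-start : {m : ℕ} (cut : ℕ → Bool) (r : Fin m) → T (isStartᵇ cut (toℕ r)) → pstF cut r ≡ r
pstF-start cut fzero    _ = refl
pstF-start cut (fsuc r) r-start with cut (suc (toℕ r))
... | true = refl

module _ (G : Setup) where
  open Setup G

  ∈⇒∈ᵇ : {j : Fin d} {S : List (Fin d)} → j ∈ S → T (_∈ᵇ_ G j S)
  ∈⇒∈ᵇ {j} j∈S = any⁺ (j ==ᶠ_) (Any.map (λ { refl → from T-≡ (dec-true (j Fin.≟ j) refl) }) j∈S)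

  sameSectionᵇ-allBut : (i : Fin d) (v w : Vtx G (full G)) → coord G v i ≡ coord G w i →
                        (u : Vtx G (full G)) →
                        sameSectionᵇ G (allBut i) v u ≡ sameSectionᵇ G (allBut i) w u
  sameSectionᵇ-allBut i v w vᵢ≡wᵢ u = cong and (map-cong agree (allFin d))
    where
    agree : (j : Fin d) → (_∈ᵇ_ G j (allBut i) ∨ (coord G v j ==ᶠ coord G u j))
                        ≡ (_∈ᵇ_ G j (allBut i) ∨ (coord G w j ==ᶠ coord G u j))
    agree j with j Fin.≟ i
    ... | yes refl = cong (λ a → _∈ᵇ_ G j (allBut j) ∨ (a ==ᶠ coord G u j)) vᵢ≡wᵢ
    ... | no j≢i rewrite to T-≡ (∈⇒∈ᵇ (∈-allBut i j≢i)) = refl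

  setCoord : Vtx G (full G) → (i : Fin d) → Fin (n i) → Vtx G (full G)
  setCoord v i a = All.updateAt (∈-allFin i) (const a) v

  coord-setCoord : (v : Vtx G (full G)) (i : Fin d) (a : Fin (n i)) → coord G (setCoord v i a) i ≡ a
  coord-setCoord v i a = lookup∘updateAt v (∈-allFin i)

  coord-setCoord-≢ : (v : Vtx G (full G)) (i : Fin d) (a : Fin (n i)) {j : Fin d} → j ≢ i →
                     coord G (setCoord v i a) j ≡ coord G v j
  coord-setCoord-≢ v i a {j} j≢i =
    lookup∘updateAt′ (∈-allFin j) (∈-allFin i) {px = coord G v j} v (λ j≡i _ → j≢i j≡i)

  partStart-self : (i : Fin d) (x : Fin (n i)) → IsPartStart G i x → partStart G i x ≡ x
  partStart-self i x x-start rewrite pstF-start (cut i) (rank G i x) x-start = inverseˡ (O i)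

  blockRanks : {S : List (Fin d)} → Vtx G S → Fin (length S) → ℕ
  blockRanks x = rkTuple G (blockStart G x)

  BLᵇ-lexᵇ-blockRanks : (S : List (Fin d)) (x y z : Vtx G S) →
                        T (BLᵇ G S x y) → T (lexᵇ (blockRanks y) (blockRanks z)) → T (BLᵇ G S x z)
  BLᵇ-lexᵇ-blockRanks S x y z x<y y<z with to T-∨ x<y
  ... | inj₁ x<y′   = from T-∨ (inj₁ (lexᵇ-trans (blockRanks x) (blockRanks y) (blockRanks z) x<y′ y<z))
  ... | inj₂ x≈y∧D = from T-∨ (inj₁ (eqTupleᵇ-lexᵇ (blockRanks x) (blockRanks y) (blockRanks z)
                                                    (proj₁ (to T-∧ x≈y∧D)) y<z))

  positionBL-mono : (S : List (Fin d)) (y z : Vtx G S) → T (lexᵇ (blockRanks y) (blockRanks z)) →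
                    positionBL G S y ≤ positionBL G S z
  positionBL-mono S y z y<z =
    countB-mono _ _ (λ x x<y → BLᵇ-lexᵇ-blockRanks S x y z x<y y<z) (allVtx G S)

  compressed-downClosed : (S : List (Fin d)) (A : Vtx G (full G) → Bool) →
    ((u : Vtx G (full G)) → compress G S A u ≡ A u) →
    (v w : Vtx G (full G)) → ((u : Vtx G (full G)) → sameSectionᵇ G S v u ≡ sameSectionᵇ G S w u) →
    positionBL G S (projFull G S v) ≤ positionBL G S (projFull G S w) → T (A w) → T (A v)
  compressed-downClosed S A compressed v w same-section v≤w w∈A =
    subst T (compressed v) (<⇒<ᵇ (≤-<-trans v≤w (subst (_ <_) (sym sectionSize-≡) w-inSegment)))
    where
    sectionSize : Vtx G (full G) → ℕ
    sectionSize x = countB (λ u → sameSectionᵇ G S x u ∧ A u) (allVtx G (full G))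
    sectionSize-≡ : sectionSize v ≡ sectionSize w
    sectionSize-≡ = countB-cong (λ u → cong (_∧ A u) (same-section u)) (allVtx G (full G))
    w-inSegment : positionBL G S (projFull G S w) < sectionSize w
    w-inSegment = <ᵇ⇒< _ _ (subst T (sym (compressed w)) w∈A)

lemma11 : (G : Setup) → StandingAssumptions G →
    (A : Vtx G (full G) → Bool) → StronglyCompressed G A →
    (i₀ : Fin (Setup.d G)) → toℕ i₀ ≡ 0 →
    (s : Vtx G (full G)) → IsFirstBlockStartOfSlice G i₀ s →
    (i : Fin (Setup.d G)) → 1 ≤ toℕ i →
    ((v : Vtx G (full G)) → ((j : Fin (Setup.d G)) → j ≢ i → coord G v j ≡ coord G s j) → T (A v)) →
    (t : Fin (Setup.n G i₀)) → IsPartStart G i₀ t → rankℕ G i₀ t < rankℕ G i₀ (coord G s i₀) →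
    (v : Vtx G (full G)) → InSlice G i₀ t v → T (A v)
lemma11 G@(record { d = suc k }) _ A compressed fzero _ s (s-blockStart , _) (fsuc i) _ line∈A t _ t<s₁ v v∈slice =
  compressed-downClosed G S A compressedAlongS v w
    (sameSectionᵇ-allBut G (fsuc i) v w (sym (coord-setCoord G s (fsuc i) _))) v≤w w∈A
  where
  S : List (Fin (suc k))
  S = allBut (fsuc i)
  w : Vtx G (full G)
  w = setCoord G s (fsuc i) (coord G v (fsuc i))
  compressedAlongS : (u : Vtx G (full G)) → compress G S A u ≡ A u
  compressedAlongS = compressed S (allBut-sorted (fsuc i)) (allBut-nonEmpty (fsuc i) {fzero} (λ ()))
                                  (length-allBut (fsuc i))
  w∈A : T (A w)
  w∈A = line∈A w (λ _ → coord-setCoord-≢ G s (fsuc i) _)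
  v₁-blockStart : partStart G fzero (coord G v fzero) ≡ t
  v₁-blockStart = trans (sym (lookup-map v (∈-allFin fzero))) v∈slice
  w₁-blockStart : partStart G fzero (coord G w fzero) ≡ coord G s fzero
  w₁-blockStart = trans (cong (partStart G fzero) (coord-setCoord-≢ G s (fsuc i) _ (λ ())))
                        (partStart-self G fzero (coord G s fzero) (s-blockStart fzero))
  -- S starts with the index 0, so these ranks are definitionally the first entries of the
  -- block-rank tuples of v and w restricted to S.
  v₁<w₁ : rankℕ G fzero (partStart G fzero (coord G v fzero))
        < rankℕ G fzero (partStart G fzero (coord G w fzero))
  v₁<w₁ = subst₂ _<_ (cong (rankℕ G fzero) (sym v₁-blockStart))
                     (cong (rankℕ G fzero) (sym w₁-blockStart)) t<s₁
  v≤w : positionBL G S (projFull G S v) ≤ positionBL G S (projFull G S w)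
  v≤w = positionBL-mono G S (projFull G S v) (projFull G S w)
          (lexᵇ-here (blockRanks G (projFull G S v)) (blockRanks G (projFull G S w)) v₁<w₁)
lemma11 (record { d = zero })  _ _ _ ()       _  _ _ _    _  _ _ _ _ _ _
lemma11 (record { d = suc k }) _ _ _ (fsuc _) () _ _ _    _  _ _ _ _ _ _
lemma11 (record { d = suc k }) _ _ _ fzero    _  _ _ fzero () _ _ _ _ _ _
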